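{- If $n,r\ge 1$ and $t\ge 2$ are integers, then $\eta_{dl}(H_{n,t,r}) = \left\lceil \frac{t + n + r - 1}{n + r}\right\rceil$.
   Context: The generalized cocktail-party graph $H_{n,t}$ ($n,t\ge 1$) is the complete $t$-partite graph in which every partite set has exactly $n$ vertices. $H_{n,t,r}$ is the graph obtained from $H_{n,t}$ by attaching $r$ new pendant vertices to each vertex of $H_{n,t}$ (i.e. the corona $H_{n,t}\circ\overline{K_r}$). For a graph $G$, $N(u)$ is the open neighborhood and $d_G(u)$ the degree of $u$. Given a vertex labeling $\ell: V(G)\to \mathbb{N}$ (positive integers), the $d$-lucky sum of $u$ is $d_\ell(u) = d_G(u) + \sum_{v\in N(u)}\ell(v)$; $\ell$ is a $d$-lucky labeling if $d_\ell(u)\neq d_\ell(v)$ for every edge $uv$. The $d$-lucky number $\eta_{dl}(G)$ is the least positive integer $k$ such that $G$ admits a $d$-lucky labeling $V(G)\to\{1,\dots,k\}$. -}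

module Defs where

open import Data.Nat using (ℕ; zero; suc; _+_; _≤_; _≟_)
open import Data.Nat.DivMod using (_/_)
open import Data.Nat.ListAction using (sum)
open import Data.Fin using (Fin; zero; suc)
open import Data.Fin.Properties using () renaming (_≟_ to _≟ᶠ_)
open import Data.Bool using (Bool; true; false; _∧_; _∨_; not; T)
open import Data.List using (List; length; map; filterᵇ; allFin; cartesianProduct)
open import Data.Product using (_×_; _,_; Σ)
open import Relation.Nullary.Decidable using (⌊_⌋)

-- A finite simple graph: a vertex type with an explicit duplicate-free
-- enumeration of all vertices and a boolean adjacency relation.
record Graph : Set₁ where
  field
    V        : Set
    vertices : List V
    adj      : V → V → Bool

open Graph public

N : (G : Graph) → V G → List (V G)
N G u = filterᵇ (adj G u) (vertices G)

deg : (G : Graph) → V G → ℕ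
deg G u = length (N G u)

dsum : (G : Graph) → (V G → ℕ) → V G → ℕ
dsum G ℓ u = deg G u + sum (map ℓ (N G u))

LabelingUpTo : (G : Graph) → ℕ → (V G → ℕ) → Set
LabelingUpTo G k ℓ = (v : V G) → 1 ≤ ℓ v × ℓ v ≤ k

IsDLucky : (G : Graph) → (V G → ℕ) → Set
IsDLucky G ℓ = (u v : V G) → T (adj G u v) → dsum G ℓ u ≢ dsum G ℓ v
  where open import Relation.Binary.PropositionalEquality using (_≢_)

HasDLuckyLabeling : Graph → ℕ → Set
HasDLuckyLabeling G k = Σ (V G → ℕ) λ ℓ → LabelingUpTo G k ℓ × IsDLucky G ℓ

DLuckyNumberIs : Graph → ℕ → Set
DLuckyNumberIs G c =
  1 ≤ c × HasDLuckyLabeling G c × ((k : ℕ) → 1 ≤ k → HasDLuckyLabeling G k → c ≤ k)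

-- ceiling division ⌈a / b⌉ for b ≥ 1 (junk value 0 for b = 0)
ceilDiv : ℕ → ℕ → ℕ
ceilDiv a zero    = 0
ceilDiv a (suc b) = (a + b) / suc b

-- H_{n,t,r}.  Vertex (i , a , zero) is the a-th vertex of the i-th partite set
-- of H_{n,t}; vertex (i , a , suc k) is the k-th pendant vertex attached to it.
HV : ℕ → ℕ → ℕ → Set
HV n t r = Fin t × Fin n × Fin (suc r)

Hadj : (n t r : ℕ) → HV n t r → HV n t r → Bool
Hadj n t r (i , a , zero)  (j , b , zero)  = not ⌊ i ≟ᶠ j ⌋
Hadj n t r (i , a , zero)  (j , b , suc _) = ⌊ i ≟ᶠ j ⌋ ∧ ⌊ a ≟ᶠ b ⌋
Hadj n t r (i , a , suc _) (j , b , zero)  = ⌊ i ≟ᶠ j ⌋ ∧ ⌊ a ≟ᶠ b ⌋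
Hadj n t r (i , a , suc _) (j , b , suc _) = false

H : ℕ → ℕ → ℕ → Graph
H n t r = record
  { V        = HV n t r
  ; vertices = cartesianProduct (allFin t) (cartesianProduct (allFin n) (allFin (suc r)))
  ; adj      = Hadj n t r
  }

module Submission where

-- For a labeling ℓ write X i = Σ_b (1 + ℓ(i,b)) for the weight of the i-th
-- partite set and Y i a = Σ_k (1 + ℓ(i,a,k)) for the weight of the pendants
-- at the core vertex (i,a).  Expanding the d-lucky sums gives
--   (core)     d_ℓ(i,a) + c = Σ_j X j + Y i a + (c - X i)   whenever X i ≤ c,
--   (pendant)  d_ℓ(k-th pendant of (i,a)) = 1 + ℓ(i,a).
-- Lower bound: for labels in {1,…,d+1} and c = n(d+2), the quantity
-- Y i a + (c - X i) lies in an interval of (n+r)d + 1 integers; core vertices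
-- of different parts are adjacent, so by (core) it is injective in i, and the
-- pigeonhole principle gives t ≤ (n+r)d + 1.
-- Upper bound: if d + 1 ≤ t ≤ (n+r)d + 1, pour i ≤ (n+r)d units greedily into
-- the labels of part i (raising pendant labels, then lowering core labels, at
-- most d per label); then Y i a + (c - X i) = 2r + i separates the parts, and
-- pendant sums stay ≤ d + 2 < 2t ≤ every core sum.
-- Since ⌈(t+n+r-1)/(n+r)⌉ ≤ d + 1 ⇔ t ≤ (n+r)d + 1, the two bounds meet.

open import Defs
open import Data.Nat using (ℕ; zero; suc; _+_; _*_; _∸_; _⊓_; _≤_; _<_; z≤n; s≤s; s≤s⁻¹)
open import Data.Nat.Properties
  using ( ≤-refl; ≤-trans; ≮⇒≥; <⇒≢; n≤1+n; +-comm; +-assoc; +-suc; +-identityʳ; +-cancelˡ-≡; +-cancelʳ-≡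
        ; +-cancelʳ-≤; +-mono-≤; +-monoˡ-≤; +-monoʳ-≤; *-monoˡ-≤; *-distribˡ-∸; m≤m+n; m≤m*n
        ; m∸n≤m; m<n⇒0<n∸m; m≤n+o⇒m∸n≤o; m+[n∸m]≡n; m+n∸m≡n; m∸n+n≡m; ∸-monoʳ-≤; ∸-cancelʳ-≡
        ; m⊓n≤m; m⊓n+n∸m≡n; +-0-commutativeMonoid; module ≤-Reasoning )
open import Data.Nat.DivMod using (_/_; _%_; m≡m%n+[m/n]*n; m%n<n; m<n*o⇒m/o<n; m≥n⇒m/n>0)
open import Data.Nat.Tactic.RingSolver using (solve-∀)
open import Data.Nat.ListAction using (sum)
open import Data.Nat.ListAction.Properties using (sum-++)
open import Data.Fin using (Fin; zero; suc; toℕ; fromℕ<; punchIn)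
open import Data.Fin.Properties using (_≟_; pigeonhole; toℕ-fromℕ<; toℕ-injective; toℕ<n; punchInᵢ≢i)
  renaming (<⇒≢ to <⇒≢ᶠ)
open import Data.Bool using (Bool; true; false; if_then_else_; not; _∧_; T)
open import Data.List using (List; []; _∷_; _++_; map; filterᵇ; length; tabulate; allFin; cartesianProduct)
open import Data.List.Properties using (map-++; map-∘; map-cong; map-tabulate)
open import Data.Product using (_×_; _,_; proj₁; proj₂)
open import Function using (_∘_; _⇔_; mk⇔; Equivalence)
open import Relation.Binary.PropositionalEquality
open import Relation.Nullary using (yes; no; contradiction)
open import Relation.Nullary.Decidable using (⌊_⌋; toWitnessFalse; fromWitnessFalse)
open import Algebra.Properties.CommutativeMonoid.Sum +-0-commutativeMonoid
  using (sum-syntax; sum-cong-≗; sum-remove; ∑-distrib-+; sum-replicate-zero)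
  renaming (sum to ∑)

open Equivalence using (to; from)

∑-const : ∀ n c → ∑[ i < n ] c ≡ n * c
∑-const zero    c = refl
∑-const (suc n) c = cong (c +_) (∑-const n c)

∑-mono-≤ : ∀ {n} {f g : Fin n → ℕ} → (∀ i → f i ≤ g i) → ∑ f ≤ ∑ g
∑-mono-≤ {zero}  f≤g = z≤n
∑-mono-≤ {suc n} f≤g = +-mono-≤ (f≤g zero) (∑-mono-≤ (f≤g ∘ suc))

∑-≥ : ∀ {n} {f : Fin n → ℕ} c → (∀ i → c ≤ f i) → n * c ≤ ∑ f
∑-≥ {n} {f} c c≤f = subst (_≤ ∑ f) (∑-const n c) (∑-mono-≤ c≤f)

∑-≤ : ∀ {n} {f : Fin n → ℕ} c → (∀ i → f i ≤ c) → ∑ f ≤ n * c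
∑-≤ {n} {f} c f≤c = subst (∑ f ≤_) (∑-const n c) (∑-mono-≤ f≤c)

∑-if : ∀ n (b : Bool) (f : Fin n → ℕ) →
       ∑[ k < n ] (if b then f k else 0) ≡ (if b then ∑ f else 0)
∑-if n true  f = refl
∑-if n false f = sum-replicate-zero n

if-≟-self : ∀ {n} {A : Set} (i : Fin n) {x y : A} → (if ⌊ i ≟ i ⌋ then x else y) ≡ x
if-≟-self i with i ≟ i
... | yes _   = refl
... | no i≢i = contradiction refl i≢i

if-≟-≢ : ∀ {n} {A : Set} {i j : Fin n} {x y : A} → j ≢ i → (if ⌊ i ≟ j ⌋ then x else y) ≡ y
if-≟-≢ {i = i} {j} j≢i with i ≟ j
... | yes i≡j = contradiction (sym i≡j) j≢i
... | no _    = refl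

+-swap-ends : ∀ a s b → a + s + b ≡ b + s + a
+-swap-ends = solve-∀

∑-exchange : ∀ {n} (i : Fin n) (f g : Fin n → ℕ) → (∀ j → j ≢ i → f j ≡ g j) →
             ∑ f + g i ≡ ∑ g + f i
∑-exchange {suc n} i f g agree = begin
  ∑ f + g i                              ≡⟨ cong (_+ g i) (sum-remove {i = i} f) ⟩
  f i + ∑ (f ∘ punchIn i) + g i          ≡⟨ cong (λ s → f i + s + g i) (sum-cong-≗ agree′) ⟩
  f i + ∑ (g ∘ punchIn i) + g i          ≡⟨ +-swap-ends (f i) _ (g i) ⟩
  g i + ∑ (g ∘ punchIn i) + f i          ≡⟨ cong (_+ f i) (sum-remove {i = i} g) ⟨
  ∑ g + f i                              ∎
  where
  open ≡-Reasoning
  agree′ : ∀ j → f (punchIn i j) ≡ g (punchIn i j)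
  agree′ j = agree (punchIn i j) (punchInᵢ≢i i j)

∑-δ : ∀ {n} (i : Fin n) (f : Fin n → ℕ) → ∑[ j < n ] (if ⌊ i ≟ j ⌋ then f j else 0) ≡ f i
∑-δ {n} i f = begin
  ∑ δf                 ≡⟨ +-identityʳ (∑ δf) ⟨
  ∑ δf + 0             ≡⟨ ∑-exchange i δf (λ _ → 0) (λ j j≢i → if-≟-≢ j≢i) ⟩
  ∑[ j < n ] 0 + δf i  ≡⟨ cong₂ _+_ (sum-replicate-zero n) (if-≟-self i) ⟩
  f i                  ∎
  where
  open ≡-Reasoning
  δf : Fin n → ℕ
  δf j = if ⌊ i ≟ j ⌋ then f j else 0

interval-pigeonhole : ∀ {t} lo m (f : Fin t → ℕ) → (∀ i → lo ≤ f i) → (∀ i → f i ≤ lo + m) →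
                      (∀ i j → f i ≡ f j → i ≡ j) → t ≤ suc m
interval-pigeonhole {t} lo m f lo≤f f≤ injective = ≮⇒≥ λ m+1<t →
  let (i , j , i<j , gi≡gj) = pigeonhole m+1<t g in <⇒≢ᶠ i<j (injective i j (g-injective gi≡gj))
  where
  offset< : ∀ i → f i ∸ lo < suc m
  offset< i = s≤s (m≤n+o⇒m∸n≤o (f i) lo (f≤ i))
  g : Fin t → Fin (suc m)
  g i = fromℕ< (offset< i)
  g-injective : ∀ {i j} → g i ≡ g j → f i ≡ f j
  g-injective {i} {j} gi≡gj = ∸-cancelʳ-≡ (lo≤f i) (lo≤f j)
    (trans (sym (toℕ-fromℕ< (offset< i))) (trans (cong toℕ gi≡gj) (toℕ-fromℕ< (offset< j))))

ceilDiv-≤⇔ : ∀ x m q → ceilDiv x (suc m) ≤ q ⇔ x ≤ q * suc m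
ceilDiv-≤⇔ x m q = mk⇔ ceil≤⇒ ⇒ceil≤
  where
  open ≤-Reasoning
  quot = (x + m) / suc m
  ceil≤⇒ : quot ≤ q → x ≤ q * suc m
  ceil≤⇒ quot≤q = ≤-trans (+-cancelʳ-≤ m x (quot * suc m) x+m≤) (*-monoˡ-≤ (suc m) quot≤q)
    where
    x+m≤ : x + m ≤ quot * suc m + m
    x+m≤ = begin
      x + m                          ≡⟨ m≡m%n+[m/n]*n (x + m) (suc m) ⟩
      (x + m) % suc m + quot * suc m ≤⟨ +-monoˡ-≤ _ (s≤s⁻¹ (m%n<n (x + m) (suc m))) ⟩
      m + quot * suc m               ≡⟨ +-comm m _ ⟩
      quot * suc m + m               ∎
  ⇒ceil≤ : x ≤ q * suc m → quot ≤ q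
  ⇒ceil≤ x≤ = s≤s⁻¹ (m<n*o⇒m/o<n (begin-strict
    x + m                ≡⟨ +-comm x m ⟩
    m + x                <⟨ s≤s (+-monoʳ-≤ m x≤) ⟩
    suc q * suc m        ∎))

ceil-≤-suc⇔ : ∀ t m k → ceilDiv (t + suc m ∸ 1) (suc m) ≤ suc k ⇔ t ≤ suc (k * suc m)
ceil-≤-suc⇔ t m k rewrite +-suc t m =
  mk⇔ (shift ∘ to (ceilDiv-≤⇔ (t + m) m (suc k))) (from (ceilDiv-≤⇔ (t + m) m (suc k)) ∘ unshift)
  where
  -- suc k * suc m is definitionally suc (m + k * suc m)
  bound≡ : suc (m + k * suc m) ≡ suc (k * suc m) + m
  bound≡ = cong suc (+-comm m (k * suc m))
  shift : t + m ≤ suc k * suc m → t ≤ suc (k * suc m)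
  shift le = +-cancelʳ-≤ m t _ (subst (t + m ≤_) bound≡ le)
  unshift : t ≤ suc (k * suc m) → t + m ≤ suc k * suc m
  unshift le = subst (t + m ≤_) (sym bound≡) (+-monoˡ-≤ m le)

ceil-pos : ∀ t m → 1 ≤ t → 1 ≤ ceilDiv (t + suc m ∸ 1) (suc m)
ceil-pos t m 1≤t rewrite +-suc t m = m≥n⇒m/n>0 (≤-trans (+-monoˡ-≤ m 1≤t) (m≤m+n (t + m) m))

-- ⌈(t + m - 1)/m⌉ ≤ t, as t ≤ (t-1)m + 1.
ceil-≤-self : ∀ t m → 1 ≤ t → ceilDiv (t + suc m ∸ 1) (suc m) ≤ t
ceil-≤-self (suc t) m _ = from (ceil-≤-suc⇔ (suc t) m t) (s≤s (m≤m*n t (suc m)))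

filter-weighted : ∀ {A : Set} (p : A → Bool) (f : A → ℕ) (xs : List A) →
  length (filterᵇ p xs) + sum (map f (filterᵇ p xs)) ≡ sum (map (λ x → if p x then suc (f x) else 0) xs)
filter-weighted p f []       = refl
filter-weighted p f (x ∷ xs) with p x
... | false = filter-weighted p f xs
... | true  = cong suc (begin
  L + (f x + S) ≡⟨ +-left-comm L (f x) S ⟩
  f x + (L + S) ≡⟨ cong (f x +_) (filter-weighted p f xs) ⟩
  f x + _       ∎)
  where
  open ≡-Reasoning
  L = length (filterᵇ p xs)
  S = sum (map f (filterᵇ p xs))
  +-left-comm : ∀ a b c → a + (b + c) ≡ b + (a + c)
  +-left-comm = solve-∀

sum-cartesianProduct : ∀ {A B : Set} (f : A × B → ℕ) (xs : List A) (ys : List B) →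
  sum (map f (cartesianProduct xs ys)) ≡ sum (map (λ x → sum (map (λ y → f (x , y)) ys)) xs)
sum-cartesianProduct f []       ys = refl
sum-cartesianProduct f (x ∷ xs) ys = begin
  sum (map f (map (x ,_) ys ++ cartesianProduct xs ys))
    ≡⟨ cong sum (map-++ f (map (x ,_) ys) _) ⟩
  sum (map f (map (x ,_) ys) ++ map f (cartesianProduct xs ys))
    ≡⟨ sum-++ (map f (map (x ,_) ys)) _ ⟩
  sum (map f (map (x ,_) ys)) + sum (map f (cartesianProduct xs ys))
    ≡⟨ cong₂ _+_ (cong sum (sym (map-∘ ys))) (sum-cartesianProduct f xs ys) ⟩
  _ ∎
  where open ≡-Reasoning

sum-allFin : ∀ n (f : Fin n → ℕ) → sum (map f (allFin n)) ≡ ∑ f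
sum-allFin n f = trans (cong sum (map-tabulate (λ i → i) f)) (sum-tabulate f)
  where
  sum-tabulate : ∀ {n} (g : Fin n → ℕ) → sum (tabulate g) ≡ ∑ g
  sum-tabulate {zero}  g = refl
  sum-tabulate {suc n} g = cong (g zero +_) (sum-tabulate (g ∘ suc))

-- The contribution of v to the d-lucky sum of u; by filter-weighted,
-- dsum G ℓ u is the sum of these over all vertices v.
weight : (G : Graph) → (V G → ℕ) → V G → V G → ℕ
weight G ℓ u v = if adj G u v then suc (ℓ v) else 0

dsum-H : ∀ {n t r} (ℓ : HV n t r → ℕ) u →
  dsum (H n t r) ℓ u ≡ ∑[ j < t ] ∑[ b < n ] ∑[ c < suc r ] weight (H n t r) ℓ u (j , b , c)
dsum-H {n} {t} {r} ℓ u = begin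
  dsum (H n t r) ℓ u
    ≡⟨ filter-weighted (adj (H n t r) u) ℓ (vertices (H n t r)) ⟩
  sum (map w (cartesianProduct (allFin t) (cartesianProduct (allFin n) (allFin (suc r)))))
    ≡⟨ sum-cartesianProduct w (allFin t) _ ⟩
  sum (map (λ j → sum (map (λ y → w (j , y)) (cartesianProduct (allFin n) (allFin (suc r))))) (allFin t))
    ≡⟨ sum-allFin t _ ⟩
  ∑[ j < t ] sum (map (λ y → w (j , y)) (cartesianProduct (allFin n) (allFin (suc r))))
    ≡⟨ sum-cong-≗ (λ j → sum-cartesianProduct (λ y → w (j , y)) (allFin n) (allFin (suc r))) ⟩
  ∑[ j < t ] sum (map (λ b → sum (map (λ c → w (j , b , c)) (allFin (suc r)))) (allFin n))
    ≡⟨ sum-cong-≗ (λ j → trans (cong sum (map-cong (λ b → sum-allFin (suc r) (λ c → w (j , b , c))) (allFin n)))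
                                (sum-allFin n (λ b → ∑[ c < suc r ] w (j , b , c)))) ⟩
  ∑[ j < t ] ∑[ b < n ] ∑[ c < suc r ] w (j , b , c) ∎
  where
  open ≡-Reasoning
  w = weight (H n t r) ℓ u

module Weights {n t r : ℕ} (ℓ : HV n t r → ℕ) where

  X : Fin t → ℕ
  X i = ∑[ b < n ] suc (ℓ (i , b , zero))

  Y : Fin t → Fin n → ℕ
  Y i a = ∑[ k < r ] suc (ℓ (i , a , suc k))

  D : Fin t → Fin n → ℕ
  D i a = dsum (H n t r) ℓ (i , a , zero)

  +∑0 : ∀ x → x + ∑[ k < r ] 0 ≡ x
  +∑0 x = trans (cong (x +_) (sum-replicate-zero r)) (+-identityʳ x)

  -- The j-th part (with its pendants) contributes to d_ℓ(i,a) all of X j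
  -- if j ≠ i, and only the pendants of (i,a) if j = i.
  core-part : ∀ i a j →
    ∑[ b < n ] ((if not ⌊ i ≟ j ⌋ then suc (ℓ (j , b , zero)) else 0)
               + ∑[ k < r ] (if ⌊ i ≟ j ⌋ ∧ ⌊ a ≟ b ⌋ then suc (ℓ (j , b , suc k)) else 0))
    ≡ (if ⌊ i ≟ j ⌋ then Y i a else X j)
  core-part i a j with i ≟ j
  ... | yes refl = trans (sum-cong-≗ (λ b → ∑-if r ⌊ a ≟ b ⌋ (λ k → suc (ℓ (i , b , suc k)))))
                         (∑-δ a (Y i))
  ... | no _     = sum-cong-≗ (λ b → +∑0 (suc (ℓ (j , b , zero))))

  core-dsum : ∀ i a → D i a ≡ ∑[ j < t ] (if ⌊ i ≟ j ⌋ then Y i a else X j)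
  core-dsum i a = trans (dsum-H ℓ (i , a , zero)) (sum-cong-≗ (core-part i a))

  core-balance : ∀ {c} i a → X i ≤ c → D i a + c ≡ ∑ X + (Y i a + (c ∸ X i))
  core-balance {c} i a Xi≤c = begin
    D i a + c                      ≡⟨ cong (D i a +_) (m+[n∸m]≡n Xi≤c) ⟨
    D i a + (X i + (c ∸ X i))      ≡⟨ +-assoc (D i a) (X i) _ ⟨
    D i a + X i + (c ∸ X i)        ≡⟨ cong (λ s → s + X i + (c ∸ X i)) (core-dsum i a) ⟩
    ∑ part + X i + (c ∸ X i)       ≡⟨ cong (_+ (c ∸ X i)) (∑-exchange i part X (λ j j≢i → if-≟-≢ j≢i)) ⟩
    ∑ X + part i + (c ∸ X i)       ≡⟨ cong (λ y → ∑ X + y + (c ∸ X i)) (if-≟-self i) ⟩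
    ∑ X + Y i a + (c ∸ X i)        ≡⟨ +-assoc (∑ X) (Y i a) _ ⟩
    ∑ X + (Y i a + (c ∸ X i))      ∎
    where
    open ≡-Reasoning
    part : Fin t → ℕ
    part j = if ⌊ i ≟ j ⌋ then Y i a else X j

  -- A pendant only sees its core vertex.
  pendant-part : ∀ i a j →
    ∑[ b < n ] ((if ⌊ i ≟ j ⌋ ∧ ⌊ a ≟ b ⌋ then suc (ℓ (j , b , zero)) else 0) + ∑[ k < r ] 0)
    ≡ (if ⌊ i ≟ j ⌋ then suc (ℓ (i , a , zero)) else 0)
  pendant-part i a j with i ≟ j
  ... | yes refl = trans (sum-cong-≗ (λ b → +∑0 (if ⌊ a ≟ b ⌋ then suc (ℓ (i , b , zero)) else 0)))
                         (∑-δ a (λ b → suc (ℓ (i , b , zero))))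
  ... | no _     = trans (sum-cong-≗ {n} (λ b → sum-replicate-zero r)) (sum-replicate-zero n)

  pendant-dsum : ∀ i a k → dsum (H n t r) ℓ (i , a , suc k) ≡ suc (ℓ (i , a , zero))
  pendant-dsum i a k = trans (dsum-H ℓ (i , a , suc k))
    (trans (sum-cong-≗ (pendant-part i a)) (∑-δ i (λ _ → suc (ℓ (i , a , zero)))))

core-adjacent : ∀ {n t r} (i j : Fin t) (a b : Fin n) → i ≢ j → T (Hadj n t r (i , a , zero) (j , b , zero))
core-adjacent i j a b = fromWitnessFalse

≤-if : ∀ (b : Bool) {c x y} → c ≤ x → c ≤ y → c ≤ (if b then x else y)
≤-if true  c≤x _   = c≤x
≤-if false _   c≤y = c≤y

module LabelBounds {n t r k : ℕ} {ℓ : HV n t r → ℕ} (labels : LabelingUpTo (H n t r) k ℓ) where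
  open Weights ℓ

  X-≥ : ∀ i → n * 2 ≤ X i
  X-≥ i = ∑-≥ 2 (λ b → s≤s (proj₁ (labels (i , b , zero))))

  X-≤ : ∀ i → X i ≤ n * suc k
  X-≤ i = ∑-≤ (suc k) (λ b → s≤s (proj₂ (labels (i , b , zero))))

  Y-≥ : ∀ i a → r * 2 ≤ Y i a
  Y-≥ i a = ∑-≥ 2 (λ k → s≤s (proj₁ (labels (i , a , suc k))))

  Y-≤ : ∀ i a → Y i a ≤ r * suc k
  Y-≤ i a = ∑-≤ (suc k) (λ k → s≤s (proj₂ (labels (i , a , suc k))))

  -- Every part contributes at least 2 to a core sum, so core sums are ≥ 2t.
  D-≥ : 1 ≤ n → 1 ≤ r → ∀ i a → t * 2 ≤ D i a
  D-≥ 1≤n 1≤r i a = subst (t * 2 ≤_) (sym (core-dsum i a))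
    (∑-≥ 2 (λ j → ≤-if ⌊ i ≟ j ⌋ (≤-trans (*-monoˡ-≤ 2 1≤r) (Y-≥ i a))
                                  (≤-trans (*-monoˡ-≤ 2 1≤n) (X-≥ j))))

lower-bound : ∀ {n t r d} → Fin n → HasDLuckyLabeling (H n t r) (suc d) → t ≤ suc (d * (n + r))
lower-bound {n} {t} {r} {d} a₀ (ℓ , labels , lucky) =
  interval-pigeonhole (r * 2) (d * (n + r)) Q Q-≥ Q-≤ Q-injective
  where
  open Weights ℓ
  open LabelBounds labels
  c = n * suc (suc d)
  -- the part-dependent term of d_ℓ(i,a₀) + c in (core)
  Q : Fin t → ℕ
  Q i = Y i a₀ + (c ∸ X i)
  Q-≥ : ∀ i → r * 2 ≤ Q i
  Q-≥ i = ≤-trans (Y-≥ i a₀) (m≤m+n _ _)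
  Q-≤ : ∀ i → Q i ≤ r * 2 + d * (n + r)
  Q-≤ i = begin
    Y i a₀ + (c ∸ X i)         ≤⟨ +-mono-≤ (Y-≤ i a₀) (∸-monoʳ-≤ c (X-≥ i)) ⟩
    r * suc (suc d) + (c ∸ n * 2) ≡⟨ cong (r * suc (suc d) +_) (*-distribˡ-∸ n (suc (suc d)) 2) ⟨
    r * suc (suc d) + n * d    ≡⟨ regroup r d n ⟩
    r * 2 + d * (n + r)        ∎
    where
    open ≤-Reasoning
    regroup : ∀ r d n → r * suc (suc d) + n * d ≡ r * 2 + d * (n + r)
    regroup = solve-∀
  Q-injective : ∀ i j → Q i ≡ Q j → i ≡ j
  Q-injective i j Qi≡Qj with i ≟ j
  ... | yes i≡j = i≡j
  ... | no i≢j  = contradiction D-equal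
                    (lucky (i , a₀ , zero) (j , a₀ , zero) (core-adjacent {r = r} i j a₀ a₀ i≢j))
    where
    D-equal : D i a₀ ≡ D j a₀
    D-equal = +-cancelʳ-≡ c _ _ (begin
      D i a₀ + c     ≡⟨ core-balance i a₀ (X-≤ i) ⟩
      ∑ X + Q i      ≡⟨ cong (∑ X +_) Qi≡Qj ⟩
      ∑ X + Q j      ≡⟨ core-balance j a₀ (X-≤ j) ⟨
      D j a₀ + c     ∎)
      where open ≡-Reasoning

-- Greedy distribution of e units into slots of capacity d: slot s receives
-- fill d e s units.
fill : ∀ {K} → ℕ → ℕ → Fin K → ℕ
fill d e zero    = d ⊓ e
fill d e (suc s) = fill d (e ∸ d) s

fill-≤ : ∀ {K} d e (s : Fin K) → fill d e s ≤ d
fill-≤ d e zero    = m⊓n≤m d e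
fill-≤ d e (suc s) = fill-≤ d (e ∸ d) s

∑-fill : ∀ K d e → e ≤ K * d → ∑[ s < K ] fill d e s ≡ e
∑-fill zero    d zero z≤n = refl
∑-fill (suc K) d e e≤ = begin
  d ⊓ e + ∑[ s < K ] fill d (e ∸ d) s ≡⟨ cong (d ⊓ e +_) (∑-fill K d (e ∸ d) (m≤n+o⇒m∸n≤o e d e≤)) ⟩
  d ⊓ e + (e ∸ d)                     ≡⟨ m⊓n+n∸m≡n d e ⟩
  e                                   ∎
  where open ≡-Reasoning

suc-<-double : ∀ {t} → 2 ≤ t → suc t < t * 2
suc-<-double {t} 2≤t = subst (suc t <_) (double t) (+-monoˡ-≤ t 2≤t)
  where
  double : ∀ t → t + t ≡ t * 2
  double = solve-∀

module UpperBound (n t r d : ℕ) (1≤n : 1 ≤ n) (1≤r : 1 ≤ r) (2≤t : 2 ≤ t)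
                  (d<t : suc d ≤ t) (t≤ : t ≤ suc (d * (n + r))) where

  -- part i carries the excess toℕ i ≤ d(n+r): up to r·d of it raises
  -- pendant labels, the rest lowers core labels
  pendant-excess core-excess : Fin t → ℕ
  pendant-excess i = r * d ⊓ toℕ i
  core-excess i    = toℕ i ∸ r * d

  ℓ : HV n t r → ℕ
  ℓ (i , a , zero)  = suc d ∸ fill d (core-excess i) a
  ℓ (i , a , suc k) = suc (fill d (pendant-excess i) k)

  labels : LabelingUpTo (H n t r) (suc d) ℓ
  labels (i , a , zero)  = m<n⇒0<n∸m (s≤s (fill-≤ d (core-excess i) a))
                         , m∸n≤m (suc d) (fill d (core-excess i) a)
  labels (i , a , suc k) = s≤s z≤n , s≤s (fill-≤ d (pendant-excess i) k)

  open Weights ℓ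
  open LabelBounds labels using (D-≥)

  core-excess-≤ : ∀ i → core-excess i ≤ n * d
  core-excess-≤ i = m≤n+o⇒m∸n≤o (toℕ i) (r * d)
    (subst (toℕ i ≤_) (split d n r) (s≤s⁻¹ (≤-trans (toℕ<n i) t≤)))
    where
    split : ∀ d n r → d * (n + r) ≡ r * d + n * d
    split = solve-∀

  Y-value : ∀ i a → Y i a ≡ r * 2 + pendant-excess i
  Y-value i a = begin
    ∑[ k < r ] (2 + fill d (pendant-excess i) k)     ≡⟨ ∑-distrib-+ {r} (λ _ → 2) (fill d (pendant-excess i)) ⟩
    ∑[ k < r ] 2 + ∑[ k < r ] fill d (pendant-excess i) k
      ≡⟨ cong₂ _+_ (∑-const r 2) (∑-fill r d (pendant-excess i) (m⊓n≤m (r * d) (toℕ i))) ⟩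
    r * 2 + pendant-excess i                        ∎
    where open ≡-Reasoning

  X-value : ∀ i → X i + core-excess i ≡ n * suc (suc d)
  X-value i = begin
    X i + core-excess i                      ≡⟨ cong (X i +_) (∑-fill n d (core-excess i) (core-excess-≤ i)) ⟨
    ∑[ b < n ] suc (ℓ (i , b , zero)) + ∑[ b < n ] fill d (core-excess i) b
      ≡⟨ ∑-distrib-+ (λ b → suc (ℓ (i , b , zero))) (fill d (core-excess i)) ⟨
    ∑[ b < n ] (suc (ℓ (i , b , zero)) + fill d (core-excess i) b)
      ≡⟨ sum-cong-≗ {n} (λ b → cong suc (m∸n+n≡m (≤-trans (fill-≤ d (core-excess i) b) (n≤1+n d)))) ⟩
    ∑[ b < n ] suc (suc d)                  ≡⟨ ∑-const n (suc (suc d)) ⟩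
    n * suc (suc d)                         ∎
    where open ≡-Reasoning

  -- (core) with c = n(d+2): the part-dependent term is 2r + toℕ i
  core-value : ∀ i a → D i a + n * suc (suc d) ≡ ∑ X + (r * 2 + toℕ i)
  core-value i a = begin
    D i a + n * suc (suc d)
      ≡⟨ core-balance i a (subst (X i ≤_) (X-value i) (m≤m+n (X i) (core-excess i))) ⟩
    ∑ X + (Y i a + (n * suc (suc d) ∸ X i))       ≡⟨ cong₂ (λ y s → ∑ X + (y + s)) (Y-value i a) slack ⟩
    ∑ X + (r * 2 + pendant-excess i + core-excess i) ≡⟨ cong (∑ X +_) (+-assoc (r * 2) _ _) ⟩
    ∑ X + (r * 2 + (pendant-excess i + core-excess i))
      ≡⟨ cong (λ e → ∑ X + (r * 2 + e)) (m⊓n+n∸m≡n (r * d) (toℕ i)) ⟩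
    ∑ X + (r * 2 + toℕ i)                        ∎
    where
    open ≡-Reasoning
    slack : n * suc (suc d) ∸ X i ≡ core-excess i
    slack = trans (cong (_∸ X i) (sym (X-value i))) (m+n∸m≡n (X i) (core-excess i))

  -- a pendant sum is at most d + 2 < 2t, below every core sum
  pendant<core : ∀ i a k j b → dsum (H n t r) ℓ (i , a , suc k) < D j b
  pendant<core i a k j b = begin-strict
    dsum (H n t r) ℓ (i , a , suc k) ≡⟨ pendant-dsum i a k ⟩
    suc (ℓ (i , a , zero))           ≤⟨ s≤s (proj₂ (labels (i , a , zero))) ⟩
    suc (suc d)                      ≤⟨ s≤s d<t ⟩
    suc t                            <⟨ suc-<-double 2≤t ⟩
    t * 2                            ≤⟨ D-≥ 1≤n 1≤r j b ⟩
    D j b                            ∎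
    where open ≤-Reasoning

  lucky : IsDLucky (H n t r) ℓ
  -- core sums determine the part (core-value); pendant sums are smaller
  lucky (i , a , zero)  (j , b , zero)  adjacent eq = toWitnessFalse adjacent (toℕ-injective
    (+-cancelˡ-≡ (r * 2) _ _ (+-cancelˡ-≡ (∑ X) _ _
      (trans (sym (core-value i a)) (trans (cong (_+ n * suc (suc d)) eq) (core-value j b))))))
  lucky (i , a , zero)  (j , b , suc k) _ eq = contradiction (sym eq) (<⇒≢ (pendant<core j b k i a))
  lucky (i , a , suc k) (j , b , zero)  _ eq = contradiction eq (<⇒≢ (pendant<core i a k j b))
  lucky (i , a , suc k) (j , b , suc l) ()

  upper-bound : HasDLuckyLabeling (H n t r) (suc d)
  upper-bound = ℓ , labels , lucky

theorem3p2 : (n t r : ℕ) → 1 ≤ n → 1 ≤ r → 2 ≤ t →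
    DLuckyNumberIs (H n t r) (ceilDiv (t + n + r ∸ 1) (n + r))
theorem3p2 zero      t r () _ _
theorem3p2 n@(suc n′) t r 1≤n 1≤r 2≤t rewrite +-assoc t n r
  with ceilDiv (t + (n + r) ∸ 1) (n + r)
     | ceil-pos t (n′ + r) (≤-trans (n≤1+n 1) 2≤t)
     | ceil-≤-self t (n′ + r) (≤-trans (n≤1+n 1) 2≤t)
     | ceil-≤-suc⇔ t (n′ + r)
... | zero  | () | _   | _
... | suc d | _  | d<t | ceil≤⇔ = s≤s z≤n , labeling , minimal
  where
  -- with ⌈…⌉ = d + 1: d + 1 ≤ t, and t ≤ d(n+r) + 1 by the ceiling bound
  labeling : HasDLuckyLabeling (H n t r) (suc d)
  labeling = UpperBound.upper-bound n t r d 1≤n 1≤r 2≤t d<t (to (ceil≤⇔ d) ≤-refl)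
  -- a labeling into {1,…,k+1} gives t ≤ k(n+r) + 1, i.e. ⌈…⌉ ≤ k + 1
  minimal : ∀ k → 1 ≤ k → HasDLuckyLabeling (H n t r) k → suc d ≤ k
  minimal (suc k) _ has = from (ceil≤⇔ k) (lower-bound zero has)
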